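{- Let $D$ be a graph without loops with $D\in\mathcal{U}$. Then $D$ has a perfect $2$-matching.
   Context: A graph is a symmetric digraph: $(u,v)$ is an arc iff $(v,u)$ is; an edge is such a pair with $u\neq v$. $D\in\mathcal{U}$ means there is a unitary matrix $U$, indexed by the vertices, with $U_{v,w}\neq0$ iff $(v,w)$ is an arc. A perfect $2$-matching of a graph is a spanning subgraph whose components are vertex-disjoint single edges and cycles (covering all vertices). -}

module Defs where

open import Level using (0ℓ)
open import Data.Nat using (ℕ; _≤_)
open import Data.Fin using (Fin)
open import Data.Bool using (Bool; true; false)
open import Data.List using (List; []; _∷_; _++_; [_]; length; concatMap; allFin)
open import Data.List.Relation.Unary.Linked using (Linked)
open import Data.List.Relation.Binary.Permutation.Propositional using (_↭_)
open import Data.Product using (Σ; _×_; _,_; ∃)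
open import Data.Sum using (_⊎_)
open import Relation.Nullary using (¬_)
open import Relation.Binary.PropositionalEquality using (_≡_)
open import Algebra.Bundles using (CommutativeRing)

-- The real numbers, axiomatised as a (Dedekind-)complete ordered field.
-- (agda-stdlib has no reals; any model of these axioms is, classically,
-- isomorphic to ℝ.)

record RealField : Set₁ where
  field
    realRing : CommutativeRing 0ℓ 0ℓ
  open CommutativeRing realRing public
  field
    _<_      : Carrier → Carrier → Set
    <-irrefl : ∀ {x y} → x ≈ y → ¬ (x < y)
    <-trans  : ∀ {x y z} → x < y → y < z → x < z
    <-cmp    : ∀ x y → x < y ⊎ (x ≈ y ⊎ y < x)
    <-resp-≈ : ∀ {x x' y y'} → x ≈ x' → y ≈ y' → x < y → x' < y'
    +-mono-< : ∀ {x y} z → x < y → (x + z) < (y + z)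
    *-pos    : ∀ {x y} → 0# < x → 0# < y → 0# < (x * y)
    0<1      : 0# < 1#
    inverse  : ∀ x → ¬ (x ≈ 0#) → Σ Carrier λ y → (x * y) ≈ 1#
    sup      : (P : Carrier → Set) → (∃ λ x → P x) →
               (∃ λ b → ∀ x → P x → (x < b ⊎ x ≈ b)) →
               Σ Carrier λ s → (∀ x → P x → (x < s ⊎ x ≈ s)) ×
                               (∀ b → (∀ x → P x → (x < b ⊎ x ≈ b)) → (s < b ⊎ s ≈ b))

module ComplexMatrices (ℝ : RealField) where
  open RealField ℝ

  ℂ : Set
  ℂ = Carrier × Carrier

  re im : ℂ → Carrier
  re (a , _) = a
  im (_ , b) = b

  _+ℂ_ _*ℂ_ : ℂ → ℂ → ℂ
  (a , b) +ℂ (c , d) = (a + c , b + d)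
  (a , b) *ℂ (c , d) = (a * c - b * d , a * d + b * c)

  conj : ℂ → ℂ
  conj (a , b) = (a , - b)

  0ℂ 1ℂ : ℂ
  0ℂ = (0# , 0#)
  1ℂ = (1# , 0#)

  _≈ℂ_ : ℂ → ℂ → Set
  z ≈ℂ w = (re z ≈ re w) × (im z ≈ im w)

  Σℂ : ∀ {n} → (Fin n → ℂ) → ℂ
  Σℂ {ℕ.zero}  f = 0ℂ
  Σℂ {ℕ.suc n} f = f Fin.zero +ℂ Σℂ (λ i → f (Fin.suc i))

  Matrix : ℕ → Set
  Matrix n = Fin n → Fin n → ℂ

  δ : ∀ {n} → Fin n → Fin n → ℂ
  δ Fin.zero    Fin.zero    = 1ℂ
  δ Fin.zero    (Fin.suc _) = 0ℂ
  δ (Fin.suc _) Fin.zero    = 0ℂ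
  δ (Fin.suc i) (Fin.suc j) = δ i j

  _† : ∀ {n} → Matrix n → Matrix n
  (U †) i j = conj (U j i)

  _·_ : ∀ {n} → Matrix n → Matrix n → Matrix n
  (U · V) i k = Σℂ (λ j → U i j *ℂ V j k)

  IsUnitary : ∀ {n} → Matrix n → Set
  IsUnitary U = (∀ i k → ((U †) · U) i k ≈ℂ δ i k) ×
                (∀ i k → (U · (U †)) i k ≈ℂ δ i k)

record Graph (n : ℕ) : Set where
  field
    arc  : Fin n → Fin n → Bool
    symm : ∀ v w → arc v w ≡ arc w v
open Graph public

Loopless : ∀ {n} → Graph n → Set
Loopless D = ∀ v → arc D v v ≡ false

InU : ∀ {n} → RealField → Graph n → Set
InU {n} ℝ D = Σ (Matrix n) λ U → IsUnitary U ×
                (∀ v w → (¬ (U v w ≈ℂ 0ℂ)) ⇔ (arc D v w ≡ true))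
  where
    open ComplexMatrices ℝ
    _⇔_ : Set → Set → Set
    A ⇔ B = (A → B) × (B → A)

Adj : ∀ {n} → Graph n → Fin n → Fin n → Set
Adj D v w = arc D v w ≡ true

-- A component of the spanning subgraph: a single edge, or a cycle
-- x ∷ ys (length ≥ 3, consecutive vertices adjacent, last adjacent to x).
data Piece {n : ℕ} (D : Graph n) : Set where
  edge  : (u v : Fin n) → Adj D u v → Piece D
  cycle : (x : Fin n) (ys : List (Fin n)) → 2 ≤ length ys →
          Linked (Adj D) (x ∷ ys ++ [ x ]) → Piece D

vertices : ∀ {n} {D : Graph n} → Piece D → List (Fin n)
vertices (edge u v _)      = u ∷ v ∷ []
vertices (cycle x ys _ _)  = x ∷ ys

-- A perfect 2-matching: a family of pieces (edges and cycles of D)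
-- that are vertex-disjoint and cover every vertex, i.e. the list of all
-- their vertices is a permutation of the vertex set (each vertex occurs
-- exactly once).
PerfectTwoMatching : ∀ {n} → Graph n → Set
PerfectTwoMatching {n} D =
  Σ (List (Piece D)) λ ps → concatMap vertices ps ↭ allFin n

module Submission where

-- If U is unitary with the zero pattern of D, the matrix (∣U i j∣²) is doubly stochastic and is
-- supported on the arcs of D. The rows indexed by a vertex set S carry total mass ∣ S ∣, all of it
-- in the columns of the out-neighbours N(S) of S, which carry mass ∣ N(S) ∣; so ∣ S ∣ ≤ ∣ N(S) ∣,
-- and Hall's theorem gives a permutation σ with an arc from every v to σ v. As D has no loops,
-- every cycle of σ has length at least 2: the 2-cycles are edges of D, the longer ones are cycles
-- of D, and together they cover each vertex exactly once.

open import Defs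
open import Data.Nat using (ℕ)

module HallsTheorem where

  open import Data.Nat using (suc; _+_; _≤_; _<_; z≤n; _≤?_)
  open import Data.Nat.Properties
    using ( ≤-trans; ≤-reflexive; m≤m+n; +-suc; +-identityʳ; +-monoʳ-≤; +-cancelʳ-≤; ≰⇒>; ≤-pred
          ; module ≤-Reasoning)
  open import Data.Nat.Induction using (<-wellFounded)
  open import Data.Fin using (Fin)
  open import Data.Fin.Properties using (any?)
  open import Data.Bool using (if_then_else_)
  open import Data.Vec using ([]; _∷_; tabulate; there)
  open import Data.Vec.Properties using (lookup∘tabulate; lookup⇒[]=; []=⇒lookup)
  open import Data.Fin.Subset
  open import Data.Fin.Subset.Properties
  open import Data.Product using (∃; _×_; _,_; proj₁; proj₂)
  open import Data.Sum using (inj₁; inj₂)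
  open import Function using (_∘_; id; const)
  open import Function.Definitions using (Injective)
  open import Induction.WellFounded using (Acc; acc)
  open import Relation.Unary using (Pred)
  open import Relation.Binary using (Decidable)
  open import Relation.Nullary using (¬_; Dec; yes; no; does; contradiction; _×-dec_)
  open import Relation.Nullary.Decidable using (dec-true)
  open import Relation.Binary.PropositionalEquality using (_≡_; _≢_; refl; sym; trans; cong; subst)

  private
    variable
      n : ℕ
      p q r : Subset n
      x : Fin n

  ∣p∪q∣+∣p∩q∣≡∣p∣+∣q∣ : (p q : Subset n) → ∣ p ∪ q ∣ + ∣ p ∩ q ∣ ≡ ∣ p ∣ + ∣ q ∣
  ∣p∪q∣+∣p∩q∣≡∣p∣+∣q∣ []            []            = refl
  ∣p∪q∣+∣p∩q∣≡∣p∣+∣q∣ (outside ∷ p) (outside ∷ q) = ∣p∪q∣+∣p∩q∣≡∣p∣+∣q∣ p q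
  ∣p∪q∣+∣p∩q∣≡∣p∣+∣q∣ (inside  ∷ p) (outside ∷ q) = cong suc (∣p∪q∣+∣p∩q∣≡∣p∣+∣q∣ p q)
  ∣p∪q∣+∣p∩q∣≡∣p∣+∣q∣ (outside ∷ p) (inside  ∷ q) =
    trans (cong suc (∣p∪q∣+∣p∩q∣≡∣p∣+∣q∣ p q)) (sym (+-suc ∣ p ∣ ∣ q ∣))
  ∣p∪q∣+∣p∩q∣≡∣p∣+∣q∣ (inside  ∷ p) (inside  ∷ q) = cong suc (begin
    ∣ p ∪ q ∣ + suc ∣ p ∩ q ∣ ≡⟨ +-suc ∣ p ∪ q ∣ ∣ p ∩ q ∣ ⟩
    suc (∣ p ∪ q ∣ + ∣ p ∩ q ∣) ≡⟨ cong suc (∣p∪q∣+∣p∩q∣≡∣p∣+∣q∣ p q) ⟩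
    suc (∣ p ∣ + ∣ q ∣)       ≡⟨ +-suc ∣ p ∣ ∣ q ∣ ⟨
    ∣ p ∣ + suc ∣ q ∣         ∎)
    where open Relation.Binary.PropositionalEquality.≡-Reasoning

  ∣p∪q∣≤∣p∣+∣q∣ : (p q : Subset n) → ∣ p ∪ q ∣ ≤ ∣ p ∣ + ∣ q ∣
  ∣p∪q∣≤∣p∣+∣q∣ p q = ≤-trans (m≤m+n _ _) (≤-reflexive (∣p∪q∣+∣p∩q∣≡∣p∣+∣q∣ p q))

  p⊆q∪r⇒∣p∣≤∣q∣+∣r∣ : p ⊆ q ∪ r → ∣ p ∣ ≤ ∣ q ∣ + ∣ r ∣
  p⊆q∪r⇒∣p∣≤∣q∣+∣r∣ {q = q} {r = r} p⊆q∪r = ≤-trans (p⊆q⇒∣p∣≤∣q∣ p⊆q∪r) (∣p∪q∣≤∣p∣+∣q∣ q r)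

  Empty⇒∣p∣≡0 : ∀ {n} {p : Subset n} → Empty p → ∣ p ∣ ≡ 0
  Empty⇒∣p∣≡0 {n} p≡∅ = trans (cong ∣_∣ (Empty-unique p≡∅)) (∣⊥∣≡0 n)

  Empty[p∩q]⇒∣p∪q∣≡∣p∣+∣q∣ : (p q : Subset n) → Empty (p ∩ q) → ∣ p ∪ q ∣ ≡ ∣ p ∣ + ∣ q ∣
  Empty[p∩q]⇒∣p∪q∣≡∣p∣+∣q∣ p q disjoint = begin
    ∣ p ∪ q ∣                 ≡⟨ +-identityʳ ∣ p ∪ q ∣ ⟨
    ∣ p ∪ q ∣ + 0             ≡⟨ cong (∣ p ∪ q ∣ +_) (Empty⇒∣p∣≡0 disjoint) ⟨
    ∣ p ∪ q ∣ + ∣ p ∩ q ∣     ≡⟨ ∣p∪q∣+∣p∩q∣≡∣p∣+∣q∣ p q ⟩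
    ∣ p ∣ + ∣ q ∣             ∎
    where open Relation.Binary.PropositionalEquality.≡-Reasoning

  0<∣p∣⇒Nonempty : 0 < ∣ p ∣ → Nonempty p
  0<∣p∣⇒Nonempty {p = p} 0<∣p∣ with nonempty? p
  ... | yes p≢∅ = p≢∅
  ... | no  p≡∅ with () ← subst (0 <_) (Empty⇒∣p∣≡0 p≡∅) 0<∣p∣

  x∈p─q⇒x∉q : x ∈ p ─ q → x ∉ q
  x∈p─q⇒x∉q {p = _ ∷ _} {q = _ ∷ _} (there x∈p─q) (there x∈q) = x∈p─q⇒x∉q x∈p─q x∈q

  x∈p⇒⁅x⁆⊆p : x ∈ p → ⁅ x ⁆ ⊆ p
  x∈p⇒⁅x⁆⊆p {x = x} {p = p} x∈p y∈⁅x⁆ = subst (_∈ p) (sym (x∈⁅y⁆⇒x≡y x y∈⁅x⁆)) x∈p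

  toSubset : ∀ {ℓ} {P : Pred (Fin n) ℓ} → Relation.Unary.Decidable P → Subset n
  toSubset P? = tabulate (does ∘ P?)

  module _ {ℓ} {P : Pred (Fin n) ℓ} (P? : Relation.Unary.Decidable P) where

    ∈-toSubset⁺ : P x → x ∈ toSubset P?
    ∈-toSubset⁺ {x = x} px = lookup⇒[]= x _ (trans (lookup∘tabulate _ x) (dec-true (P? x) px))

    ∈-toSubset⁻ : x ∈ toSubset P? → P x
    ∈-toSubset⁻ {x = x} x∈ with P? x | trans (sym (lookup∘tabulate (does ∘ P?) x)) ([]=⇒lookup x∈)
    ... | yes px | _ = px

  module Bipartite {n : ℕ} {R : Fin n → Fin n → Set} (R? : Decidable R) where

    neighbour? : ∀ S j → Dec (∃ λ i → i ∈ S × R i j)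
    neighbour? S j = any? (λ i → (i ∈? S) ×-dec R? i j)

    neighbours : Subset n → Subset n
    neighbours S = toSubset (neighbour? S)

    ∈-neighbours⁺ : ∀ {S i j} → i ∈ S → R i j → j ∈ neighbours S
    ∈-neighbours⁺ {S} {i} i∈S Rij = ∈-toSubset⁺ (neighbour? S) (i , i∈S , Rij)

    ∈-neighbours⁻ : ∀ {S j} → j ∈ neighbours S → ∃ λ i → i ∈ S × R i j
    ∈-neighbours⁻ {S} = ∈-toSubset⁻ (neighbour? S)

    neighbours-mono : ∀ {S T} → S ⊆ T → neighbours S ⊆ neighbours T
    neighbours-mono S⊆T j∈NS with i , i∈S , Rij ← ∈-neighbours⁻ j∈NS = ∈-neighbours⁺ (S⊆T i∈S) Rij

    HallCondition : Subset n → Subset n → Set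
    HallCondition A B = ∀ S → S ⊆ A → ∣ S ∣ ≤ ∣ B ∩ neighbours S ∣

    record Matching (A B : Subset n) : Set where
      field
        match           : Fin n → Fin n
        match-∈         : ∀ {i} → i ∈ A → match i ∈ B
        match-related   : ∀ {i} → i ∈ A → R i (match i)
        match-injective : ∀ {i j} → i ∈ A → j ∈ A → match i ≡ match j → i ≡ j

    emptyMatching : ∀ {A B} → Empty A → Matching A B
    emptyMatching A≡∅ = record
      { match           = id
      ; match-∈         = λ i∈A → contradiction (_ , i∈A) A≡∅
      ; match-related   = λ i∈A → contradiction (_ , i∈A) A≡∅
      ; match-injective = λ i∈A _ _ → contradiction (_ , i∈A) A≡∅
      }

    singletonMatching : ∀ {B i j} → j ∈ B → R i j → Matching ⁅ i ⁆ (B ∩ ⁅ j ⁆)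
    singletonMatching {i = i} {j} j∈B Rij = record
      { match           = const j
      ; match-∈         = λ _ → x∈p∩q⁺ (j∈B , x∈⁅x⁆ j)
      ; match-related   = λ k∈⁅i⁆ → subst (λ k → R k j) (sym (x∈⁅y⁆⇒x≡y i k∈⁅i⁆)) Rij
      ; match-injective = λ k∈⁅i⁆ l∈⁅i⁆ _ → trans (x∈⁅y⁆⇒x≡y i k∈⁅i⁆) (sym (x∈⁅y⁆⇒x≡y i l∈⁅i⁆))
      }

    combine : ∀ {A B} S C → Matching S (B ∩ C) → Matching (A ─ S) (B ─ C) → Matching A B
    combine {A} {B} S C M₁ M₂ = record
      { match           = match
      ; match-∈         = match-∈
      ; match-related   = match-related
      ; match-injective = match-injective
      }
      where
        module M₁ = Matching M₁
        module M₂ = Matching M₂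

        match : Fin n → Fin n
        match k = if does (k ∈? S) then M₁.match k else M₂.match k

        outside-S : ∀ {i} → i ∈ A → i ∉ S → i ∈ A ─ S
        outside-S = x∈p∧x∉q⇒x∈p─q

        match-∈ : ∀ {i} → i ∈ A → match i ∈ B
        match-∈ {i} i∈A with i ∈? S
        ... | yes i∈S = proj₁ (x∈p∩q⁻ B C (M₁.match-∈ i∈S))
        ... | no  i∉S = p─q⊆p B C (M₂.match-∈ (outside-S i∈A i∉S))

        match-related : ∀ {i} → i ∈ A → R i (match i)
        match-related {i} i∈A with i ∈? S
        ... | yes i∈S = M₁.match-related i∈S
        ... | no  i∉S = M₂.match-related (outside-S i∈A i∉S)

        separated : ∀ {i j} → i ∈ S → j ∈ A ─ S → M₁.match i ≢ M₂.match j
        separated i∈S j∈A─S eq = x∈p─q⇒x∉q (M₂.match-∈ j∈A─S)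
          (subst (_∈ C) eq (proj₂ (x∈p∩q⁻ B C (M₁.match-∈ i∈S))))

        match-injective : ∀ {i j} → i ∈ A → j ∈ A → match i ≡ match j → i ≡ j
        match-injective {i} {j} i∈A j∈A eq with i ∈? S | j ∈? S
        ... | yes i∈S | yes j∈S = M₁.match-injective i∈S j∈S eq
        ... | no  i∉S | no  j∉S = M₂.match-injective (outside-S i∈A i∉S) (outside-S j∈A j∉S) eq
        ... | yes i∈S | no  j∉S = contradiction eq (separated i∈S (outside-S j∈A j∉S))
        ... | no  i∉S | yes j∈S = contradiction (sym eq) (separated j∈S (outside-S i∈A i∉S))

    hallCondition-⊆ : ∀ {A B S} → HallCondition A B → S ⊆ A → HallCondition S (B ∩ neighbours S)
    hallCondition-⊆ {B = B} {S} hall S⊆A T T⊆S =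
      ≤-trans (hall T (S⊆A ∘ T⊆S)) (p⊆q⇒∣p∣≤∣q∣ restrict)
      where
        restrict : B ∩ neighbours T ⊆ (B ∩ neighbours S) ∩ neighbours T
        restrict j∈ with j∈B , j∈NT ← x∈p∩q⁻ B (neighbours T) j∈ =
          x∈p∩q⁺ (x∈p∩q⁺ (j∈B , neighbours-mono T⊆S j∈NT) , j∈NT)

    hallCondition-─ : ∀ {A B S} → HallCondition A B → S ⊆ A → ∣ B ∩ neighbours S ∣ ≤ ∣ S ∣ →
                      HallCondition (A ─ S) (B ─ neighbours S)
    hallCondition-─ {A} {B} {S} hall S⊆A tight T T⊆A─S = +-cancelʳ-≤ ∣ S ∣ ∣ T ∣ _ (begin
      ∣ T ∣ + ∣ S ∣                                         ≡⟨ Empty[p∩q]⇒∣p∪q∣≡∣p∣+∣q∣ T S disjoint ⟨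
      ∣ T ∪ S ∣                                             ≤⟨ hall (T ∪ S) T∪S⊆A ⟩
      ∣ B ∩ neighbours (T ∪ S) ∣                            ≤⟨ p⊆q∪r⇒∣p∣≤∣q∣+∣r∣ split ⟩
      ∣ (B ─ neighbours S) ∩ neighbours T ∣ + ∣ B ∩ neighbours S ∣ ≤⟨ +-monoʳ-≤ _ tight ⟩
      ∣ (B ─ neighbours S) ∩ neighbours T ∣ + ∣ S ∣          ∎)
      where
        open ≤-Reasoning

        disjoint : Empty (T ∩ S)
        disjoint (i , i∈T∩S) with i∈T , i∈S ← x∈p∩q⁻ T S i∈T∩S = x∈p─q⇒x∉q (T⊆A─S i∈T) i∈S

        T∪S⊆A : T ∪ S ⊆ A
        T∪S⊆A i∈T∪S with x∈p∪q⁻ T S i∈T∪S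
        ... | inj₁ i∈T = p─q⊆p A S (T⊆A─S i∈T)
        ... | inj₂ i∈S = S⊆A i∈S

        split : B ∩ neighbours (T ∪ S) ⊆ (B ─ neighbours S) ∩ neighbours T ∪ B ∩ neighbours S
        split {j} j∈ with j∈B , j∈N ← x∈p∩q⁻ B _ j∈ | j ∈? neighbours S
        ... | yes j∈NS = x∈p∪q⁺ (inj₂ (x∈p∩q⁺ (j∈B , j∈NS)))
        ... | no  j∉NS with i , i∈T∪S , Rij ← ∈-neighbours⁻ j∈N | x∈p∪q⁻ T S i∈T∪S
        ...   | inj₁ i∈T = x∈p∪q⁺ (inj₁ (x∈p∩q⁺ (x∈p∧x∉q⇒x∈p─q j∈B j∉NS , ∈-neighbours⁺ i∈T Rij)))
        ...   | inj₂ i∈S = contradiction (∈-neighbours⁺ i∈S Rij) j∉NS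

    Surplus : Subset n → Subset n → Set
    Surplus A B = ∀ T → Nonempty T → T ⊂ A → ∣ T ∣ < ∣ B ∩ neighbours T ∣

    surplus⇒hallCondition-─⁅⁆ : ∀ {A B i j} → Surplus A B → i ∈ A →
                                HallCondition (A ─ ⁅ i ⁆) (B ─ ⁅ j ⁆)
    surplus⇒hallCondition-─⁅⁆ {A} {B} {i} {j} surplus i∈A T T⊆A-i with nonempty? T
    ... | no  T≡∅ = subst (_≤ ∣ (B ─ ⁅ j ⁆) ∩ neighbours T ∣) (sym (Empty⇒∣p∣≡0 T≡∅)) z≤n
    ... | yes T≢∅ = ≤-pred (begin
      suc ∣ T ∣                                 ≤⟨ surplus T T≢∅ T⊂A ⟩
      ∣ B ∩ neighbours T ∣                      ≤⟨ p⊆q∪r⇒∣p∣≤∣q∣+∣r∣ split ⟩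
      ∣ ⁅ j ⁆ ∣ + ∣ (B ─ ⁅ j ⁆) ∩ neighbours T ∣ ≡⟨ cong (_+ ∣ (B ─ ⁅ j ⁆) ∩ neighbours T ∣) (∣⁅x⁆∣≡1 j) ⟩
      suc ∣ (B ─ ⁅ j ⁆) ∩ neighbours T ∣        ∎)
      where
        open ≤-Reasoning

        T⊂A : T ⊂ A
        T⊂A = p─q⊆p A ⁅ i ⁆ ∘ T⊆A-i , i , i∈A , λ i∈T → x∈p─q⇒x∉q (T⊆A-i i∈T) (x∈⁅x⁆ i)

        split : B ∩ neighbours T ⊆ ⁅ j ⁆ ∪ (B ─ ⁅ j ⁆) ∩ neighbours T
        split {k} k∈ with k∈B , k∈NT ← x∈p∩q⁻ B _ k∈ | k ∈? ⁅ j ⁆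
        ... | yes k∈⁅j⁆ = x∈p∪q⁺ (inj₁ k∈⁅j⁆)
        ... | no  k∉⁅j⁆ = x∈p∪q⁺ (inj₂ (x∈p∩q⁺ (x∈p∧x∉q⇒x∈p─q k∈B k∉⁅j⁆ , k∈NT)))

    hallCondition⇒partner : ∀ {A B i} → HallCondition A B → i ∈ A → ∃ λ j → j ∈ B × R i j
    hallCondition⇒partner {A} {B} {i} hall i∈A
      with j , j∈ ← 0<∣p∣⇒Nonempty (≤-trans (≤-reflexive (sym (∣⁅x⁆∣≡1 i))) (hall ⁅ i ⁆ (x∈p⇒⁅x⁆⊆p i∈A)))
      with j∈B , j∈N ← x∈p∩q⁻ B _ j∈
      with k , k∈⁅i⁆ , Rkj ← ∈-neighbours⁻ j∈N
      = j , j∈B , subst (λ k → R k j) (x∈⁅y⁆⇒x≡y i k∈⁅i⁆) Rkj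

    Tight : Subset n → Subset n → Subset n → Set
    Tight A B S = Nonempty S × S ⊂ A × ∣ B ∩ neighbours S ∣ ≤ ∣ S ∣

    tight? : ∀ A B S → Dec (Tight A B S)
    tight? A B S = nonempty? S ×-dec S ⊂? A ×-dec ∣ B ∩ neighbours S ∣ ≤? ∣ S ∣

    ¬tight⇒surplus : ∀ {A B} → ¬ (∃ (Tight A B)) → Surplus A B
    ¬tight⇒surplus ¬tight T T≢∅ T⊂A = ≰⇒> (λ T-tight → ¬tight (T , T≢∅ , T⊂A , T-tight))

    -- Halmos–Vaughan: a tight S splits the problem into S and A ─ S; if there is none, every
    -- proper subset of A has a spare neighbour, so any i ∈ A may be matched to any partner first.
    hall-acc : ∀ {A B} → Acc _<_ ∣ A ∣ → HallCondition A B → Matching A B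
    hall-acc {A} {B} (acc smaller) hall with anySubset? (tight? A B)
    ... | yes (S , (s , s∈S) , S⊂A , tight) =
      combine S (neighbours S)
        (hall-acc (smaller (p⊂q⇒∣p∣<∣q∣ S⊂A)) (hallCondition-⊆ {B = B} hall (p⊂q⇒p⊆q S⊂A)))
        (hall-acc (smaller (p∩q≢∅⇒∣p─q∣<∣p∣ A S (s , x∈p∩q⁺ (p⊂q⇒p⊆q S⊂A s∈S , s∈S))))
                  (hallCondition-─ {B = B} hall (p⊂q⇒p⊆q S⊂A) tight))
    ... | no ¬tight with nonempty? A
    ...   | no  A≡∅      = emptyMatching A≡∅
    ...   | yes (i , i∈A) with j , j∈B , Rij ← hallCondition⇒partner hall i∈A =
      combine ⁅ i ⁆ ⁅ j ⁆
        (singletonMatching j∈B Rij)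
        (hall-acc (smaller (x∈p⇒∣p-x∣<∣p∣ i∈A))
                  (surplus⇒hallCondition-─⁅⁆ {B = B} {j = j} (¬tight⇒surplus {B = B} ¬tight) i∈A))

    hall : ∀ {A B} → HallCondition A B → Matching A B
    hall = hall-acc (<-wellFounded _)

    perfectMatching : (∀ S → ∣ S ∣ ≤ ∣ neighbours S ∣) →
                      ∃ λ σ → Injective _≡_ _≡_ σ × (∀ i → R i (σ i))
    perfectMatching expanding = match , match-injective ∈⊤ ∈⊤ , λ _ → match-related ∈⊤
      where
        hallCondition : HallCondition ⊤ ⊤
        hallCondition S _ =
          ≤-trans (expanding S) (p⊆q⇒∣p∣≤∣q∣ {q = ⊤ ∩ neighbours S} λ j∈ → x∈p∩q⁺ (∈⊤ , j∈))
        open Matching (hall {⊤} {⊤} hallCondition)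

module UnitaryExpansion where

  open import Data.Nat as ℕ using (zero; suc)
  import Data.Nat.Properties as ℕ
  open import Data.Fin using (Fin)
  import Data.Fin as Fin
  open import Function using (_∘_)
  open import Data.Fin.Subset using (Subset; ∣_∣; inside; outside)
  open import Data.Bool using (Bool; true; false; if_then_else_)
  open import Data.Vec using ([]; _∷_; lookup)
  open import Data.Vec.Properties using (lookup⇒[]=; []=⇒lookup)
  open import Data.Product using (_,_; proj₁; proj₂)
  open import Data.Sum using (_⊎_; inj₁; inj₂)
  import Data.Sum
  open import Relation.Nullary using (¬_; Dec; yes; no; contradiction)
  open import Relation.Binary using (Decidable; IsStrictPartialOrder; Poset)
  import Relation.Binary.Construct.StrictToNonStrict as NonStrict
  import Relation.Binary.PropositionalEquality as ≡
  import Algebra.Properties.Ring as RingProperties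

  module OrderedField (ℝ : RealField) where
    open RealField ℝ public
    open import Algebra.Properties.Semiring.Sum semiring public
      using (sum; sum-syntax; sum-cong-≋; ∑-comm; sum-replicate-zero)
    open import Algebra.Properties.Semiring.Mult semiring public using (_×_)
    open RingProperties ring using (-‿distribˡ-*; -‿distribʳ-*; -‿involutive)

    <-isStrictPartialOrder : IsStrictPartialOrder _≈_ _<_
    <-isStrictPartialOrder = record
      { isEquivalence = isEquivalence
      ; irrefl        = <-irrefl
      ; trans         = <-trans
      ; <-resp-≈      = (λ y≈z x<y → <-resp-≈ refl y≈z x<y) , (λ y≈z y<x → <-resp-≈ y≈z refl y<x)
      }

    open NonStrict _≈_ _<_ public using (_≤_)

    ≤-poset : Poset _ _ _
    ≤-poset = record { isPartialOrder = NonStrict.isPartialOrder _≈_ _<_ <-isStrictPartialOrder }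

    open Poset ≤-poset public
      using () renaming (refl to ≤-refl; reflexive to ≤-reflexive; trans to ≤-trans)

    +-monoˡ-≤ : ∀ {x y} z → x ≤ y → x + z ≤ y + z
    +-monoˡ-≤ z (inj₁ x<y) = inj₁ (+-mono-< z x<y)
    +-monoˡ-≤ z (inj₂ x≈y) = inj₂ (+-cong x≈y refl)

    +-mono-≤ : ∀ {x y u v} → x ≤ y → u ≤ v → x + u ≤ y + v
    +-mono-≤ {x} {y} {u} {v} x≤y u≤v = ≤-trans (+-monoˡ-≤ u x≤y)
      (≤-trans (≤-reflexive (+-comm y u)) (≤-trans (+-monoˡ-≤ y u≤v) (≤-reflexive (+-comm v y))))

    0≤x+y : ∀ {x y} → 0# ≤ x → 0# ≤ y → 0# ≤ x + y
    0≤x+y 0≤x 0≤y = ≤-trans (≤-reflexive (sym (+-identityˡ 0#))) (+-mono-≤ 0≤x 0≤y)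

    0≤x*x : ∀ x → 0# ≤ x * x
    0≤x*x x with <-cmp x 0#
    ... | inj₁ x<0        = inj₁ (<-resp-≈ refl -x*-x≈x*x (*-pos 0<-x 0<-x))
      where
        0<-x : 0# < (- x)
        0<-x = <-resp-≈ (-‿inverseʳ x) (+-identityˡ (- x)) (+-mono-< (- x) x<0)
        -x*-x≈x*x : (- x) * (- x) ≈ x * x
        -x*-x≈x*x = trans (sym (-‿distribˡ-* x (- x)))
                   (trans (-‿cong (sym (-‿distribʳ-* x x))) (-‿involutive (x * x)))
    ... | inj₂ (inj₁ x≈0) = inj₂ (sym (trans (*-cong x≈0 refl) (zeroˡ x)))
    ... | inj₂ (inj₂ 0<x) = inj₁ (*-pos 0<x 0<x)

    ≈0? : ∀ x → Dec (x ≈ 0#)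
    ≈0? x with <-cmp x 0#
    ... | inj₁ x<0        = no λ x≈0 → <-irrefl x≈0 x<0
    ... | inj₂ (inj₁ x≈0) = yes x≈0
    ... | inj₂ (inj₂ 0<x) = no λ x≈0 → <-irrefl (sym x≈0) 0<x

    ∑-mono-≤ : ∀ {n} {f g : Fin n → Carrier} → (∀ i → f i ≤ g i) → sum f ≤ sum g
    ∑-mono-≤ {zero}  f≤g = ≤-refl
    ∑-mono-≤ {suc n} f≤g = +-mono-≤ (f≤g Fin.zero) (∑-mono-≤ (f≤g ∘ Fin.suc))

    n×1#<1+n×1# : ∀ n → (n × 1#) < (suc n × 1#)
    n×1#<1+n×1# n = <-resp-≈ (+-identityˡ (n × 1#)) refl (+-mono-< (n × 1#) 0<1)

    ×1#-mono-< : ∀ {m n} → m ℕ.< n → (m × 1#) < (n × 1#)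
    ×1#-mono-< {m} {suc n} (ℕ.s≤s m≤n) with ℕ.m≤n⇒m<n∨m≡n m≤n
    ... | inj₁ m<n    = <-trans (×1#-mono-< m<n) (n×1#<1+n×1# n)
    ... | inj₂ ≡.refl = n×1#<1+n×1# n

    ×1#-cancel-≤ : ∀ {m n} → m × 1# ≤ n × 1# → m ℕ.≤ n
    ×1#-cancel-≤ {m} {n} m≤n with m ℕ.≤? n
    ... | yes m≤n = m≤n
    ... | no  m≰n with ×1#-mono-< (ℕ.≰⇒> m≰n) | m≤n
    ...   | n<m | inj₁ m<n = contradiction (<-trans n<m m<n) (<-irrefl refl)
    ...   | n<m | inj₂ m≈n = contradiction n<m (<-irrefl (sym m≈n))

  module DoublyStochastic (ℝ : RealField) {n : ℕ} {R : Fin n → Fin n → Set} (R? : Decidable R) where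
    open OrderedField ℝ
    open HallsTheorem.Bipartite R? using (neighbours; ∈-neighbours⁺)

    when : Bool → Carrier → Carrier
    when b x = if b then x else 0#

    when-cong : ∀ b {x y} → x ≈ y → when b x ≈ when b y
    when-cong true  x≈y = x≈y
    when-cong false _   = refl

    0≤when : ∀ b {x} → 0# ≤ x → 0# ≤ when b x
    0≤when true  0≤x = 0≤x
    0≤when false _   = ≤-refl

    when-sum : ∀ {m} b (f : Fin m → Carrier) → when b (sum f) ≈ ∑[ j < m ] when b (f j)
    when-sum     true  f = refl
    when-sum {m} false f = sym (sum-replicate-zero m)

    ∑-when-1# : ∀ {m} (S : Subset m) → ∑[ i < m ] when (lookup S i) 1# ≈ ∣ S ∣ × 1#
    ∑-when-1# []            = refl
    ∑-when-1# (inside  ∷ S) = +-congˡ (∑-when-1# S)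
    ∑-when-1# (outside ∷ S) = trans (+-identityˡ _) (∑-when-1# S)

    module _ (P : Fin n → Fin n → Carrier) (nonneg : ∀ i j → 0# ≤ P i j)
             (rows : ∀ i → ∑[ j < n ] P i j ≈ 1#) (columns : ∀ j → ∑[ i < n ] P i j ≈ 1#)
             (support : ∀ i j → P i j ≈ 0# ⊎ R i j) where

      mass-moves-to-neighbours : ∀ S i j →
                                 when (lookup S i) (P i j) ≤ when (lookup (neighbours S) j) (P i j)
      mass-moves-to-neighbours S i j with lookup S i in i∈S | lookup (neighbours S) j in j∈N[S]
      ... | false | b     = 0≤when b (nonneg i j)
      ... | true  | true  = ≤-refl
      ... | true  | false with support i j
      ...   | inj₁ Pij≈0 = ≤-reflexive Pij≈0
      ...   | inj₂ Rij
        with () ← ≡.trans (≡.sym ([]=⇒lookup (∈-neighbours⁺ (lookup⇒[]= i S i∈S) Rij))) j∈N[S]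

      doublyStochastic⇒expanding : ∀ S → ∣ S ∣ ℕ.≤ ∣ neighbours S ∣
      doublyStochastic⇒expanding S = ×1#-cancel-≤ (begin
        ∣ S ∣ × 1#                                          ≈⟨ ∑-when-1# S ⟨
        ∑[ i < n ] when (lookup S i) 1#                     ≈⟨ sum-cong-≋ (λ i → when-cong (lookup S i) (rows i)) ⟨
        ∑[ i < n ] when (lookup S i) (∑[ j < n ] P i j)     ≈⟨ sum-cong-≋ (λ i → when-sum (lookup S i) (P i)) ⟩
        ∑[ i < n ] ∑[ j < n ] when (lookup S i) (P i j)     ≤⟨ ∑-mono-≤ (λ i → ∑-mono-≤ (mass-moves-to-neighbours S i)) ⟩
        ∑[ i < n ] ∑[ j < n ] when (lookup N[S] j) (P i j)  ≈⟨ ∑-comm (λ i j → when (lookup N[S] j) (P i j)) ⟩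
        ∑[ j < n ] ∑[ i < n ] when (lookup N[S] j) (P i j)  ≈⟨ sum-cong-≋ (λ j → when-sum (lookup N[S] j) (λ i → P i j)) ⟨
        ∑[ j < n ] when (lookup N[S] j) (∑[ i < n ] P i j)  ≈⟨ sum-cong-≋ (λ j → when-cong (lookup N[S] j) (columns j)) ⟩
        ∑[ j < n ] when (lookup N[S] j) 1#                  ≈⟨ ∑-when-1# N[S] ⟩
        ∣ N[S] ∣ × 1#                                       ∎)
        where
          open import Relation.Binary.Reasoning.PartialOrder ≤-poset
          N[S] = neighbours S

  module UnitaryMatrices (ℝ : RealField) where
    open OrderedField ℝ
    open ComplexMatrices ℝ
    open RingProperties ring using (-‿distribˡ-*; -‿distribʳ-*; -‿involutive)

    ∣_∣² : ℂ → Carrier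
    ∣ z ∣² = re z * re z + im z * im z

    0≤∣z∣² : ∀ z → 0# ≤ ∣ z ∣²
    0≤∣z∣² z = 0≤x+y (0≤x*x (re z)) (0≤x*x (im z))

    ∣z∣²≈0⊎z≉0 : ∀ z → ∣ z ∣² ≈ 0# ⊎ ¬ (z ≈ℂ 0ℂ)
    ∣z∣²≈0⊎z≉0 z with ≈0? (re z) | ≈0? (im z)
    ... | yes re≈0 | yes im≈0 = inj₁ (trans (+-cong (*0 re≈0) (*0 im≈0)) (+-identityˡ 0#))
      where
        *0 : ∀ {x} → x ≈ 0# → x * x ≈ 0#
        *0 {x} x≈0 = trans (*-cong x≈0 refl) (zeroˡ x)
    ... | no re≉0 | _         = inj₂ (re≉0 ∘ proj₁)
    ... | yes _   | no im≉0   = inj₂ (im≉0 ∘ proj₂)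

    re[z̄z]≈∣z∣² : ∀ z → re (conj z *ℂ z) ≈ ∣ z ∣²
    re[z̄z]≈∣z∣² (a , b) = +-congˡ (trans (-‿cong (sym (-‿distribˡ-* b b))) (-‿involutive (b * b)))

    re[zz̄]≈∣z∣² : ∀ z → re (z *ℂ conj z) ≈ ∣ z ∣²
    re[zz̄]≈∣z∣² (a , b) = +-congˡ (trans (-‿cong (sym (-‿distribʳ-* b b))) (-‿involutive (b * b)))

    re-Σℂ : ∀ {n} (f : Fin n → ℂ) → re (Σℂ f) ≡.≡ ∑[ i < n ] re (f i)
    re-Σℂ {zero}  f = ≡.refl
    re-Σℂ {suc n} f = ≡.cong (re (f Fin.zero) +_) (re-Σℂ (f ∘ Fin.suc))

    δ-diagonal : ∀ {n} (i : Fin n) → δ i i ≡.≡ 1ℂ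
    δ-diagonal Fin.zero    = ≡.refl
    δ-diagonal (Fin.suc i) = δ-diagonal i

    module _ {n} {U : Matrix n} (unitary : IsUnitary U) where

      unitary⇒columns : ∀ j → ∑[ i < n ] ∣ U i j ∣² ≈ 1#
      unitary⇒columns j = begin
        ∑[ i < n ] ∣ U i j ∣²                   ≈⟨ sum-cong-≋ (λ i → re[z̄z]≈∣z∣² (U i j)) ⟨
        ∑[ i < n ] re (conj (U i j) *ℂ U i j)   ≡⟨ re-Σℂ (λ i → conj (U i j) *ℂ U i j) ⟨
        re (((U †) · U) j j)                    ≈⟨ proj₁ (proj₁ unitary j j) ⟩
        re (δ j j)                              ≡⟨ ≡.cong re (δ-diagonal j) ⟩
        1#                                      ∎
        where open import Relation.Binary.Reasoning.Setoid setoid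

      unitary⇒rows : ∀ i → ∑[ j < n ] ∣ U i j ∣² ≈ 1#
      unitary⇒rows i = begin
        ∑[ j < n ] ∣ U i j ∣²                   ≈⟨ sum-cong-≋ (λ j → re[zz̄]≈∣z∣² (U i j)) ⟨
        ∑[ j < n ] re (U i j *ℂ conj (U i j))   ≡⟨ re-Σℂ (λ j → U i j *ℂ conj (U i j)) ⟨
        re ((U · (U †)) i i)                    ≈⟨ proj₁ (proj₂ unitary i i) ⟩
        re (δ i i)                              ≡⟨ ≡.cong re (δ-diagonal i) ⟩
        1#                                      ∎
        where open import Relation.Binary.Reasoning.Setoid setoid

      unitary⇒expanding : ∀ {R : Fin n → Fin n → Set} (R? : Decidable R) →
                          (∀ i j → ¬ (U i j ≈ℂ 0ℂ) → R i j) →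
                          ∀ S → ∣ S ∣ ℕ.≤ ∣ HallsTheorem.Bipartite.neighbours R? S ∣
      unitary⇒expanding {R} R? nonzero⇒R =
        DoublyStochastic.doublyStochastic⇒expanding ℝ R? (λ i j → ∣ U i j ∣²)
          (λ i j → 0≤∣z∣² (U i j)) unitary⇒rows unitary⇒columns support
        where
          support : ∀ i j → ∣ U i j ∣² ≈ 0# ⊎ R i j
          support i j = Data.Sum.map₂ (nonzero⇒R i j) (∣z∣²≈0⊎z≉0 (U i j))

module PermutationCycles where

  open import Data.Nat using (zero; suc; _+_; _<_; z≤n; s≤s; _≤_)
  open import Data.Nat.Properties using (m≤n⇒∃[o]m+o≡n; n<1+n; m<n⇒m<1+n; +-comm; ≤-trans; m≤m+n)
  open import Data.Nat.Induction using (<-wellFounded)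
  open import Data.Nat.GeneralisedArithmetic using (iterate)
  open import Data.Fin using (Fin; toℕ)
  open import Data.Fin.Properties using (pigeonhole; _≟_)
  open import Data.List using (List; []; _∷_; _++_; [_]; length; concatMap; allFin; filter)
  import Data.List as List
  open import Data.List.Properties using (filter-notAll)
  open import Data.List.Relation.Unary.Linked using (Linked; [-]; _∷_)
  open import Data.List.Relation.Unary.All using (tabulate)
  open import Data.List.Relation.Unary.Any using (here; there)
  import Data.List.Relation.Unary.Any as Any
  open import Data.List.Relation.Unary.Unique.Propositional using (Unique; []; _∷_)
  open import Data.List.Relation.Unary.Unique.Propositional.Properties using (allFin⁺; filter⁺; ++⁺)
  open import Data.List.Relation.Binary.Permutation.Propositional
    using (_↭_; ↭-refl; module PermutationReasoning)
  open import Data.List.Relation.Binary.Permutation.Propositional.Properties using (++⁺ˡ)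
  open import Data.List.Relation.Binary.BagAndSetEquality using (∼bag⇒↭)
  open import Data.List.Membership.Propositional using (_∈_; _∉_)
  open import Data.List.Membership.Propositional.Properties
    using (∈-++⁺ˡ; ∈-++⁺ʳ; ∈-++⁻; ∈-filter⁻; ∈-filter⁺; ∈-allFin)
  open import Data.List.Membership.Propositional.Properties.WithK using (unique∧set⇒bag)
  open import Data.Product using (Σ; ∃; _×_; _,_; proj₁; proj₂)
  open import Data.Sum using (inj₁; inj₂)
  open import Data.Empty using (⊥)
  open import Function using (_∘_)
  open import Function.Bundles using (mk⇔)
  open import Function.Definitions using (Injective)
  open import Induction.WellFounded using (Acc; acc)
  open import Relation.Unary using (Decidable)
  open import Relation.Nullary using (¬_; Dec; yes; no; ¬?; contradiction)
  open import Relation.Binary.PropositionalEquality using (_≡_; _≢_; refl; sym; trans; cong; subst)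

  private
    variable
      A : Set

  uniqueSetEqual⇒↭ : {xs ys : List A} → Unique xs → Unique ys →
                    (∀ {z} → z ∈ xs → z ∈ ys) → (∀ {z} → z ∈ ys → z ∈ xs) → xs ↭ ys
  uniqueSetEqual⇒↭ xs! ys! xs⊆ys ys⊆xs = ∼bag⇒↭ (unique∧set⇒bag xs! ys! (mk⇔ xs⊆ys ys⊆xs))

  minimal : {P : ℕ → Set} → Decidable P → ∀ k → P k → ∃ λ m → P m × (∀ {j} → j < m → ¬ P j)
  minimal P? zero    P0 = 0 , P0 , λ ()
  minimal P? (suc k) Pk with P? 0
  ... | yes P0 = 0 , P0 , λ ()
  ... | no ¬P0 with m , Pm , below ← minimal (P? ∘ suc) k Pk =
    suc m , Pm , λ { {zero} _ → ¬P0 ; {suc j} (s≤s j<m) → below j<m }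

  module _ (f : A → A) where

    iterate-suc : ∀ x k → iterate f x (suc k) ≡ f (iterate f x k)
    iterate-suc x zero    = refl
    iterate-suc x (suc k) = iterate-suc (f x) k

    iterate-+ : ∀ x a b → iterate f x (a + b) ≡ iterate f (iterate f x a) b
    iterate-+ x zero    b = refl
    iterate-+ x (suc a) b = iterate-+ (f x) a b

    ∈-iterate⁻ : ∀ {x k z} → z ∈ List.iterate f x k → ∃ λ j → j < k × z ≡ iterate f x j
    ∈-iterate⁻ {k = suc k} (here z≡x) = 0 , s≤s z≤n , z≡x
    ∈-iterate⁻ {k = suc k} (there z∈) with j , j<k , z≡ ← ∈-iterate⁻ z∈ = suc j , s≤s j<k , z≡

    ∈-iterate⁺ : ∀ {x k j} → j < k → iterate f x j ∈ List.iterate f x k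
    ∈-iterate⁺ {j = zero}  (s≤s _)   = here refl
    ∈-iterate⁺ {j = suc j} (s≤s j<k) = there (∈-iterate⁺ j<k)

    iterate-unique : ∀ x k → (∀ {a b} → a < b → b < k → iterate f x a ≢ iterate f x b) →
                     Unique (List.iterate f x k)
    iterate-unique x zero    _        = []
    iterate-unique x (suc k) distinct = tabulate head-fresh ∷ iterate-unique (f x) k distinct′
      where
        head-fresh : ∀ {z} → z ∈ List.iterate f (f x) k → x ≢ z
        head-fresh z∈ x≡z with j , j<k , z≡ ← ∈-iterate⁻ z∈ =
          distinct (s≤s z≤n) (s≤s j<k) (trans x≡z z≡)
        distinct′ : ∀ {a b} → a < b → b < k → iterate f (f x) a ≢ iterate f (f x) b
        distinct′ a<b b<k = distinct (s≤s a<b) (s≤s b<k)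

    iterate-linked : ∀ {_~_ : A → A → Set} → (∀ y → y ~ f y) →
                     ∀ x k → Linked _~_ (List.iterate f x k ++ [ iterate f x k ])
    iterate-linked step x zero          = [-]
    iterate-linked step x (suc zero)    = step x ∷ [-]
    iterate-linked step x (suc (suc k)) = step x ∷ iterate-linked step (f x) (suc k)

    iterate-cancel : Injective _≡_ _≡_ f → ∀ {x y} k → iterate f x k ≡ iterate f y k → x ≡ y
    iterate-cancel f-injective zero    x≡y = x≡y
    iterate-cancel f-injective (suc k) eq  = f-injective (iterate-cancel f-injective k eq)

  module Orbits {n : ℕ} (σ : Fin n → Fin n) (σ-injective : Injective _≡_ _≡_ σ) where

    -- Among x, σ x, …, σⁿ x two points coincide; cancelling σ gives a return to x.
    returns : ∀ x → ∃ λ d → iterate σ x (suc d) ≡ x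
    returns x
      with i , j , i<j , σⁱx≡σʲx ← pigeonhole (n<1+n n) (iterate σ x ∘ toℕ)
      with d , i+1+d≡j ← m≤n⇒∃[o]m+o≡n i<j
      = d , sym (iterate-cancel σ σ-injective (toℕ i) (begin
          iterate σ x (toℕ i)                        ≡⟨ σⁱx≡σʲx ⟩
          iterate σ x (toℕ j)                        ≡⟨ cong (iterate σ x) j≡d+1+i ⟩
          iterate σ x (suc d + toℕ i)                ≡⟨ iterate-+ σ x (suc d) (toℕ i) ⟩
          iterate σ (iterate σ x (suc d)) (toℕ i)    ∎))
      where
        open Relation.Binary.PropositionalEquality.≡-Reasoning
        j≡d+1+i : toℕ j ≡ suc d + toℕ i
        j≡d+1+i = trans (sym i+1+d≡j) (cong suc (+-comm (toℕ i) d))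

    record Orbit (x : Fin n) : Set where
      field
        last         : ℕ
        closes       : iterate σ x (suc last) ≡ x
        first-return : ∀ {j} → j < last → iterate σ x (suc j) ≢ x

      points : List (Fin n)
      points = List.iterate σ x (suc last)

      points-unique : Unique points
      points-unique = iterate-unique σ x (suc last) distinct
        where
          distinct : ∀ {a b} → a < b → b < suc last → iterate σ x a ≢ iterate σ x b
          distinct {a} {b} a<b (s≤s b≤last) σᵃx≡σᵇx
            with c , a+1+c≡b ← m≤n⇒∃[o]m+o≡n a<b
            = first-return c<last (sym (iterate-cancel σ σ-injective a (begin
                iterate σ x a                       ≡⟨ σᵃx≡σᵇx ⟩
                iterate σ x b                       ≡⟨ cong (iterate σ x) b≡c+1+a ⟩
                iterate σ x (suc c + a)             ≡⟨ iterate-+ σ x (suc c) a ⟩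
                iterate σ (iterate σ x (suc c)) a   ∎)))
            where
              open Relation.Binary.PropositionalEquality.≡-Reasoning
              b≡c+1+a : b ≡ suc c + a
              b≡c+1+a = trans (sym a+1+c≡b) (cong suc (+-comm a c))
              c<last : c < last
              c<last = ≤-trans (s≤s (m≤m+n c a)) (subst (_≤ last) b≡c+1+a b≤last)

      points-preimage : ∀ {y} → σ y ∈ points → y ∈ points
      points-preimage σy∈ with ∈-iterate⁻ σ σy∈
      ... | zero , _ , σy≡x =
        subst (_∈ points) (sym (σ-injective (trans σy≡x (trans (sym closes) (iterate-suc σ x last)))))
              (∈-iterate⁺ σ (n<1+n last))
      ... | suc j , s≤s j<last , σy≡σʲ⁺¹x =
        subst (_∈ points) (sym (σ-injective (trans σy≡σʲ⁺¹x (iterate-suc σ x j))))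
              (∈-iterate⁺ σ (m<n⇒m<1+n j<last))

    orbit : ∀ x → Orbit x
    orbit x
      with d , σᵈ⁺¹x≡x ← returns x
      with m , σᵐ⁺¹x≡x , below ← minimal (λ k → iterate σ x (suc k) ≟ x) d σᵈ⁺¹x≡x
      = record { last = m ; closes = σᵐ⁺¹x≡x ; first-return = below }

  closedWalk⇒piece : ∀ {n} {D : Graph n} → Loopless D → ∀ x ys → Linked (Adj D) (x ∷ ys ++ [ x ]) →
                     Σ (Piece D) λ piece → vertices piece ≡ x ∷ ys
  closedWalk⇒piece loopless x []            (x~x ∷ [-]) = contradiction (trans (sym x~x) (loopless x)) λ ()
  closedWalk⇒piece loopless x (y ∷ [])      (x~y ∷ _)   = edge x y x~y , refl
  closedWalk⇒piece loopless x ys@(_ ∷ _ ∷ _) walk       = cycle x ys (s≤s (s≤s z≤n)) walk , refl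

  module Decomposition {n : ℕ} (D : Graph n) (loopless : Loopless D)
    (σ : Fin n → Fin n) (σ-injective : Injective _≡_ _≡_ σ) (σ-adjacent : ∀ v → Adj D v (σ v)) where

    open Orbits σ σ-injective
    open import Data.List.Membership.DecPropositional (_≟_ {n}) using (_∈?_)

    orbitPiece : ∀ x → Σ (Piece D) λ piece → vertices piece ≡ Orbit.points (orbit x)
    orbitPiece x = closedWalk⇒piece loopless x _
      (subst (λ z → Linked (Adj D) (x ∷ List.iterate σ (σ x) last ++ [ z ])) closes
             (iterate-linked σ σ-adjacent x (suc last)))
      where open Orbit (orbit x)

    Closed : List (Fin n) → Set
    Closed R = ∀ {y} → y ∈ R → σ y ∈ R

    outsideOrbit? : ∀ x y → Dec (y ∉ Orbit.points (orbit x))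
    outsideOrbit? x y = ¬? (y ∈? Orbit.points (orbit x))

    remainder : Fin n → List (Fin n) → List (Fin n)
    remainder x = filter (outsideOrbit? x)

    module _ {x : Fin n} {R : List (Fin n)} where
      open Orbit (orbit x)

      remainder-shorter : x ∈ R → length (remainder x R) < length R
      remainder-shorter x∈R =
        filter-notAll (outsideOrbit? x) R (Any.map (λ { refl x∉points → x∉points (here refl) }) x∈R)

      remainder-closed : Closed R → Closed (remainder x R)
      remainder-closed R-closed y∈ with y∈R , y∉points ← ∈-filter⁻ (outsideOrbit? x) {xs = R} y∈ =
        ∈-filter⁺ (outsideOrbit? x) (R-closed y∈R) (y∉points ∘ points-preimage)

      points⊆ : Closed R → x ∈ R → ∀ {y} → y ∈ points → y ∈ R
      points⊆ R-closed x∈R y∈ with j , _ , refl ← ∈-iterate⁻ σ y∈ = iterate-∈ j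
        where
          iterate-∈ : ∀ j → iterate σ x j ∈ R
          iterate-∈ zero    = x∈R
          iterate-∈ (suc j) = subst (_∈ R) (sym (iterate-suc σ x j)) (R-closed (iterate-∈ j))

      points++remainder↭ : Unique R → Closed R → x ∈ R → points ++ remainder x R ↭ R
      points++remainder↭ R! R-closed x∈R =
        uniqueSetEqual⇒↭ (++⁺ points-unique (filter⁺ (outsideOrbit? x) R!) disjoint) R! to from
        where
          disjoint : ∀ {y} → y ∈ points × y ∈ remainder x R → ⊥
          disjoint (y∈points , y∈rest) = proj₂ (∈-filter⁻ (outsideOrbit? x) {xs = R} y∈rest) y∈points
          to : ∀ {y} → y ∈ points ++ remainder x R → y ∈ R
          to y∈ with ∈-++⁻ points y∈
          ... | inj₁ y∈points = points⊆ R-closed x∈R y∈points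
          ... | inj₂ y∈rest   = proj₁ (∈-filter⁻ (outsideOrbit? x) {xs = R} y∈rest)
          from : ∀ {y} → y ∈ R → y ∈ points ++ remainder x R
          from {y} y∈R with y ∈? points
          ... | yes y∈points = ∈-++⁺ˡ y∈points
          ... | no  y∉points = ∈-++⁺ʳ points (∈-filter⁺ (outsideOrbit? x) y∈R y∉points)

    decompose : ∀ R → Acc _<_ (length R) → Unique R → Closed R →
                Σ (List (Piece D)) λ pieces → concatMap vertices pieces ↭ R
    decompose []        _             _  _        = [] , ↭-refl
    decompose R@(x ∷ _) (acc smaller) R! R-closed
      with piece , piece≡points ← orbitPiece x
      with pieces , pieces↭rest ← decompose (remainder x R)
                                     (smaller (remainder-shorter {x} {R} (here refl)))
                                     (filter⁺ (outsideOrbit? x) R!) (remainder-closed {x} {R} R-closed)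
      = piece ∷ pieces , (begin
          vertices piece ++ concatMap vertices pieces ≡⟨ cong (_++ concatMap vertices pieces) piece≡points ⟩
          points ++ concatMap vertices pieces         ↭⟨ ++⁺ˡ points pieces↭rest ⟩
          points ++ remainder x R                     ↭⟨ points++remainder↭ {x} {R} R! R-closed (here refl) ⟩
          R                                           ∎)
      where
        open PermutationReasoning
        open Orbit (orbit x)

    perfectTwoMatching : PerfectTwoMatching D
    perfectTwoMatching = decompose (allFin n) (<-wellFounded _) (allFin⁺ n) (λ _ → ∈-allFin _)

open import Data.Bool using (true)
import Data.Bool as Bool
open import Data.Product using (_,_; proj₁)
open import Relation.Binary using (Decidable)
open HallsTheorem.Bipartite using (perfectMatching)
open UnitaryExpansion.UnitaryMatrices using (unitary⇒expanding)
open PermutationCycles.Decomposition using (perfectTwoMatching)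

adjacent? : ∀ {n} (D : Graph n) → Decidable (Adj D)
adjacent? D v w = arc D v w Bool.≟ true

mainTheorem10 : (ℝ : RealField) (n : ℕ) (D : Graph n) →
                Loopless D → InU ℝ D → PerfectTwoMatching D
mainTheorem10 ℝ n D loopless (U , unitary , nonzero⇔arc)
  with σ , σ-injective , σ-adjacent ← perfectMatching (adjacent? D)
         (unitary⇒expanding ℝ unitary (adjacent? D) (λ v w → proj₁ (nonzero⇔arc v w)))
  = perfectTwoMatching D loopless σ σ-injective σ-adjacent
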